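{- Let $n,k$ be positive integers with $n>2k$, and let $\sigma\in S_n$ be a permutation all of whose cycles have length greater than $k$. Let $S_{n-k}\le S_n$ be the subgroup of permutations fixing each of $n-k+1,\dots,n$. Then $S_{n-k}$ and $\langle\sigma\rangle$ invariably generate $S_n$.
   Context: Subgroups $\{H_i\}_{i\in I}$ of a group $H$ invariably generate $H$ if for every choice of $\sigma_i\in H$, the conjugates $\{\sigma_i^{ -1}H_i\sigma_i\}_{i\in I}$ generate $H$. -}

module Defs where

open import Data.Nat using (ℕ; zero; suc; _<_; _≤_; _∸_)
open import Data.Fin using (Fin; toℕ)
open import Data.Fin.Permutation using (Permutation′; _⟨$⟩ʳ_; _≈_; id; flip; _∘ₚ_)
open import Data.Product using (Σ; _×_)
open import Data.Sum using (_⊎_)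
open import Relation.Binary.PropositionalEquality using (_≡_)

_^ₚ_ : ∀ {n} → Permutation′ n → ℕ → Permutation′ n
σ ^ₚ zero = id
σ ^ₚ suc m = σ ∘ₚ (σ ^ₚ m)

IsCycleLength : ∀ {n} → Permutation′ n → Fin n → ℕ → Set
IsCycleLength σ x ℓ =
  (0 < ℓ) × ((σ ^ₚ ℓ) ⟨$⟩ʳ x ≡ x) ×
  (∀ m → 0 < m → (σ ^ₚ m) ⟨$⟩ʳ x ≡ x → ℓ ≤ m)

AllCyclesLongerThan : ∀ {n} → ℕ → Permutation′ n → Set
AllCyclesLongerThan {n} k σ = ∀ (x : Fin n) (ℓ : ℕ) → IsCycleLength σ x ℓ → k < ℓ

data Generated {n} (P : Permutation′ n → Set) : Permutation′ n → Set where
  gen   : ∀ {p} → P p → Generated P p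
  unit  : Generated P id
  mul   : ∀ {p q} → Generated P p → Generated P q → Generated P (p ∘ₚ q)
  inv   : ∀ {p} → Generated P p → Generated P (flip p)
  resp  : ∀ {p q} → p ≈ q → Generated P p → Generated P q

-- S_{n-k}: permutations fixing each of the points n-k+1,…,n
-- (with Fin n = {0,…,n-1} these are the indices i with toℕ i ≥ n ∸ k)
InStab : ∀ {n} → ℕ → Permutation′ n → Set
InStab {n} k p = ∀ (i : Fin n) → n ∸ k ≤ toℕ i → p ⟨$⟩ʳ i ≡ i

InCyclic : ∀ {n} → Permutation′ n → Permutation′ n → Set
InCyclic σ = Generated (λ p → p ≈ σ)

Conj : ∀ {n} → Permutation′ n → (Permutation′ n → Set) → Permutation′ n → Set
Conj τ H p = Σ _ λ g → H g × (p ≈ (flip τ ∘ₚ g ∘ₚ τ))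

InvariablyGenerate : ∀ {n} → (Permutation′ n → Set) → (Permutation′ n → Set) → Set
InvariablyGenerate {n} H₁ H₂ =
  ∀ (τ₁ τ₂ : Permutation′ n) (p : Permutation′ n) →
    Generated (λ q → Conj τ₁ H₁ q ⊎ Conj τ₂ H₂ q) p

-- Let s be the conjugate of σ and H the conjugate of S_{n-k} in the generated group. H is the
-- full symmetric group on a set of n - k ≥ k + 1 free points, so it contains every transposition
-- of free points. The cycles of s are longer than k, so x, s x, …, s^k x are distinct and one of
-- them, s^j x, is free, since only k points are not; likewise s^j maps one of k + 1 chosen free
-- points e to a free point. Conjugating the transposition (s^j x, s^j e) by s^{-j} joins x to a
-- free point, so every transposition lies in the generated group, and these generate S_n.
module Submission where

open import Defs
open import Data.Empty using (⊥-elim)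
open import Data.Fin using (Fin; toℕ; fromℕ<; inject≤)
open import Data.Fin.Permutation
  using (Permutation′; _⟨$⟩ʳ_; _⟨$⟩ˡ_; _≈_; id; flip; _∘ₚ_; transpose; inverseˡ; inverseʳ)
open import Data.Fin.Permutation.Transposition.List using (TranspositionList; eval; decompose; eval-decompose)
open import Data.Fin.Properties as Fin
  using (_≟_; toℕ<n; toℕ-injective; toℕ-fromℕ<; toℕ-inject≤; inject≤-injective; any?; pigeonhole)
open import Data.List using ([]; _∷_)
open import Data.Nat using (ℕ; zero; suc; _+_; _*_; _∸_; _≤_; _<_; s≤s⁻¹)
open import Data.Nat.Induction using (<-wellFounded)
open import Data.Nat.Properties
  using (_<?_; ≤-refl; ≤-trans; <-≤-trans; <⇒≤; <⇒≱; ≮⇒≥; n≤1+n; n<1+n; m∸n≤m; ∸-monoˡ-<; ∸-cancelʳ-≡;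
         m∸[m∸n]≡n; m+[n∸m]≡n; m<n⇒0<n∸m; m+n≤o⇒m≤o∸n; +-identityʳ; module ≤-Reasoning)
open import Data.Product using (∃; _×_; _,_)
open import Data.Sum using (_⊎_; inj₁; inj₂)
open import Function using (_∘_)
open import Function.Bundles using (Injection)
open import Function.Definitions using (Injective)
open import Function.Properties.Inverse using (↔⇒↣)
open import Induction.WellFounded using (Acc; acc)
open import Relation.Binary.Definitions using (tri<; tri≈; tri>)
open import Relation.Binary.PropositionalEquality using (_≡_; _≢_; refl; sym; trans; cong; subst; subst₂; module ≡-Reasoning)
open import Relation.Nullary using (Dec; yes; no)
open import Relation.Nullary.Decidable using (_×-dec_; dec-true; dec-false)

module _ {n : ℕ} where

  transpose-appˡ : (a b : Fin n) → transpose a b ⟨$⟩ʳ a ≡ b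
  transpose-appˡ a b rewrite dec-true (a ≟ a) refl = refl

  transpose-appʳ : (a b : Fin n) → transpose a b ⟨$⟩ʳ b ≡ a
  transpose-appʳ a b with b ≟ a
  ... | yes b≡a = b≡a
  ... | no _ rewrite dec-true (b ≟ b) refl = refl

  transpose-app-other : {a b x : Fin n} → x ≢ a → x ≢ b → transpose a b ⟨$⟩ʳ x ≡ x
  transpose-app-other {a} {b} {x} x≢a x≢b rewrite dec-false (x ≟ a) x≢a | dec-false (x ≟ b) x≢b = refl

  id≈transpose-self : (a : Fin n) → id ≈ transpose a a
  id≈transpose-self a x = by-cases (x ≟ a)
    where
    by-cases : Dec (x ≡ a) → x ≡ transpose a a ⟨$⟩ʳ x
    by-cases (yes refl) = sym (transpose-appˡ x x)
    by-cases (no x≢a) = sym (transpose-app-other x≢a x≢a)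

  ⟨$⟩ʳ-injective : (π : Permutation′ n) → Injective _≡_ _≡_ (π ⟨$⟩ʳ_)
  ⟨$⟩ʳ-injective π = Injection.injective (↔⇒↣ π)

  ⟨$⟩ˡ-injective : (π : Permutation′ n) → Injective _≡_ _≡_ (π ⟨$⟩ˡ_)
  ⟨$⟩ˡ-injective π = ⟨$⟩ʳ-injective (flip π)

  -- Checked at the points π y, so that the case split is on y ∈ {a, b}.
  transpose-conj : (π : Permutation′ n) (a b : Fin n) →
                   (flip π ∘ₚ transpose a b ∘ₚ π) ≈ transpose (π ⟨$⟩ʳ a) (π ⟨$⟩ʳ b)
  transpose-conj π a b x = subst (λ z → conj ⟨$⟩ʳ z ≡ t′ ⟨$⟩ʳ z) (inverseʳ π) (at-image (π ⟨$⟩ˡ x))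
    where
    conj = flip π ∘ₚ transpose a b ∘ₚ π
    t′ = transpose (π ⟨$⟩ʳ a) (π ⟨$⟩ʳ b)
    at-image : ∀ y → conj ⟨$⟩ʳ (π ⟨$⟩ʳ y) ≡ t′ ⟨$⟩ʳ (π ⟨$⟩ʳ y)
    at-image y rewrite inverseˡ π {y} = by-cases (y ≟ a) (y ≟ b)
      where
      by-cases : Dec (y ≡ a) → Dec (y ≡ b) → π ⟨$⟩ʳ (transpose a b ⟨$⟩ʳ y) ≡ t′ ⟨$⟩ʳ (π ⟨$⟩ʳ y)
      by-cases (yes refl) _ =
        trans (cong (π ⟨$⟩ʳ_) (transpose-appˡ y b)) (sym (transpose-appˡ (π ⟨$⟩ʳ y) (π ⟨$⟩ʳ b)))
      by-cases (no _) (yes refl) =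
        trans (cong (π ⟨$⟩ʳ_) (transpose-appʳ a y)) (sym (transpose-appʳ (π ⟨$⟩ʳ a) (π ⟨$⟩ʳ y)))
      by-cases (no y≢a) (no y≢b) =
        trans (cong (π ⟨$⟩ʳ_) (transpose-app-other y≢a y≢b))
              (sym (transpose-app-other (y≢a ∘ ⟨$⟩ʳ-injective π) (y≢b ∘ ⟨$⟩ʳ-injective π)))

module Transpositions {n : ℕ} {P : Permutation′ n → Set} where

  infix 4 _~_
  _~_ : Fin n → Fin n → Set
  a ~ b = Generated P (transpose a b)

  ~-refl : ∀ {a} → a ~ a
  ~-refl {a} = resp (id≈transpose-self a) unit

  -- flip (transpose a b) and transpose b a agree definitionally.
  ~-sym : ∀ {a b} → a ~ b → b ~ a
  ~-sym a~b = resp (λ _ → refl) (inv a~b)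

  ~-image : ∀ {π a b} → Generated P π → a ~ b → π ⟨$⟩ʳ a ~ π ⟨$⟩ʳ b
  ~-image {π} {a} {b} π∈ a~b = resp (transpose-conj π a b) (mul (inv π∈) (mul a~b π∈))

  -- Conjugating (b c) by (a b) gives (a c).
  ~-trans : ∀ {a b c} → a ~ b → b ~ c → a ~ c
  ~-trans {a} {b} {c} a~b b~c with c ≟ a | c ≟ b
  ... | yes refl | _ = ~-refl
  ... | no _ | yes refl = a~b
  ... | no c≢a | no c≢b =
    subst₂ _~_ (transpose-appʳ a b) (transpose-app-other c≢a c≢b) (~-image a~b b~c)

  generated-by-transpositions : (∀ a b → a ~ b) → ∀ p → Generated P p
  generated-by-transpositions all~ p = resp (eval-decompose p) (eval∈ (decompose p))
    where
    eval∈ : (xs : TranspositionList n) → Generated P (eval xs)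
    eval∈ [] = unit
    eval∈ ((a , b) ∷ xs) = mul (all~ a b) (eval∈ xs)

^ₚ-generated : ∀ {n} {P : Permutation′ n → Set} {σ} → Generated P σ → ∀ m → Generated P (σ ^ₚ m)
^ₚ-generated σ∈ zero = unit
^ₚ-generated σ∈ (suc m) = mul σ∈ (^ₚ-generated σ∈ m)

module _ {n : ℕ} (σ : Permutation′ n) where

  ^ₚ-+ : ∀ a b y → (σ ^ₚ (a + b)) ⟨$⟩ʳ y ≡ (σ ^ₚ b) ⟨$⟩ʳ ((σ ^ₚ a) ⟨$⟩ʳ y)
  ^ₚ-+ zero b y = refl
  ^ₚ-+ (suc a) b y = ^ₚ-+ a b (σ ⟨$⟩ʳ y)

  ^ₚ-conj : ∀ (τ : Permutation′ n) m x →
            ((flip τ ∘ₚ σ ∘ₚ τ) ^ₚ m) ⟨$⟩ʳ x ≡ τ ⟨$⟩ʳ ((σ ^ₚ m) ⟨$⟩ʳ (τ ⟨$⟩ˡ x))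
  ^ₚ-conj τ zero x = sym (inverseʳ τ)
  ^ₚ-conj τ (suc m) x =
    trans (^ₚ-conj τ m _) (cong (λ y → τ ⟨$⟩ʳ ((σ ^ₚ m) ⟨$⟩ʳ y)) (inverseˡ τ))

  cycleLength-≤ : ∀ {y d} → 0 < d → (σ ^ₚ d) ⟨$⟩ʳ y ≡ y → ∃ λ ℓ → IsCycleLength σ y ℓ × ℓ ≤ d
  cycleLength-≤ {y} = search (<-wellFounded _)
    where
    search : ∀ {d} → Acc _<_ d → 0 < d → (σ ^ₚ d) ⟨$⟩ʳ y ≡ y → ∃ λ ℓ → IsCycleLength σ y ℓ × ℓ ≤ d
    search {d} (acc shorter) 0<d returns
      with any? (λ (m : Fin d) → (0 <? toℕ m) ×-dec ((σ ^ₚ toℕ m) ⟨$⟩ʳ y ≟ y))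
    ... | yes (m , 0<m , returnsₘ) =
      let ℓ , isLength , ℓ≤m = search (shorter (toℕ<n m)) 0<m returnsₘ
      in  ℓ , isLength , ≤-trans ℓ≤m (<⇒≤ (toℕ<n m))
    ... | no none = d , (0<d , returns , minimal) , ≤-refl
      where
      minimal : ∀ m → 0 < m → (σ ^ₚ m) ⟨$⟩ʳ y ≡ y → d ≤ m
      minimal m 0<m returnsₘ = ≮⇒≥ λ m<d → none (fromℕ< m<d ,
        subst (λ t → 0 < t × (σ ^ₚ t) ⟨$⟩ʳ y ≡ y) (sym (toℕ-fromℕ< m<d)) (0<m , returnsₘ))

  module _ {k : ℕ} (long : AllCyclesLongerThan k σ) where

    no-short-return : ∀ {y d} → 0 < d → (σ ^ₚ d) ⟨$⟩ʳ y ≡ y → k < d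
    no-short-return 0<d returns =
      let ℓ , isLength , ℓ≤d = cycleLength-≤ 0<d returns
      in  <-≤-trans (long _ ℓ isLength) ℓ≤d

    orbit-distinct : ∀ {y a b} → a < b → b ≤ k → (σ ^ₚ a) ⟨$⟩ʳ y ≢ (σ ^ₚ b) ⟨$⟩ʳ y
    orbit-distinct {y} {a} {b} a<b b≤k eq =
      <⇒≱ (no-short-return (m<n⇒0<n∸m a<b) returns) (≤-trans (m∸n≤m b a) b≤k)
      where
      open ≡-Reasoning
      returns : (σ ^ₚ (b ∸ a)) ⟨$⟩ʳ ((σ ^ₚ a) ⟨$⟩ʳ y) ≡ (σ ^ₚ a) ⟨$⟩ʳ y
      returns = begin
        (σ ^ₚ (b ∸ a)) ⟨$⟩ʳ ((σ ^ₚ a) ⟨$⟩ʳ y) ≡⟨ sym (^ₚ-+ a (b ∸ a) y) ⟩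
        (σ ^ₚ (a + (b ∸ a))) ⟨$⟩ʳ y            ≡⟨ cong (λ t → (σ ^ₚ t) ⟨$⟩ʳ y) (m+[n∸m]≡n (<⇒≤ a<b)) ⟩
        (σ ^ₚ b) ⟨$⟩ʳ y                        ≡⟨ sym eq ⟩
        (σ ^ₚ a) ⟨$⟩ʳ y                        ∎

    orbit-injective : ∀ y → Injective _≡_ _≡_ (λ (i : Fin (suc k)) → (σ ^ₚ toℕ i) ⟨$⟩ʳ y)
    orbit-injective y {i} {j} eq with Fin.<-cmp i j
    ... | tri≈ _ i≡j _ = i≡j
    ... | tri< i<j _ _ = ⊥-elim (orbit-distinct i<j (s≤s⁻¹ (toℕ<n j)) eq)
    ... | tri> _ _ j<i = ⊥-elim (orbit-distinct j<i (s≤s⁻¹ (toℕ<n i)) (sym eq))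

injective-hits-below : ∀ {n k} → k ≤ n → (h : Fin (suc k) → Fin n) → Injective _≡_ _≡_ h →
                       ∃ λ i → toℕ (h i) < n ∸ k
injective-hits-below {n} {k} k≤n h h-inj with any? (λ i → toℕ (h i) <? n ∸ k)
... | yes found = found
... | no none with pigeonhole (n<1+n k) offset
  where
  offset-< : ∀ i → toℕ (h i) ∸ (n ∸ k) < k
  offset-< i = subst (toℕ (h i) ∸ (n ∸ k) <_) (m∸[m∸n]≡n k≤n)
                     (∸-monoˡ-< (toℕ<n (h i)) (≮⇒≥ (none ∘ (i ,_))))
  offset : Fin (suc k) → Fin k
  offset i = fromℕ< (offset-< i)
... | i , j , i<j , same-offset = ⊥-elim (Fin.<-irrefl (h-inj (toℕ-injective same-value)) i<j)
  where
  same-value : toℕ (h i) ≡ toℕ (h j)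
  same-value = ∸-cancelʳ-≡ (≮⇒≥ (none ∘ (i ,_))) (≮⇒≥ (none ∘ (j ,_)))
    (trans (sym (toℕ-fromℕ< _)) (trans (cong toℕ same-offset) (toℕ-fromℕ< _)))

transpose∈InStab : ∀ {n} k {a b : Fin n} → toℕ a < n ∸ k → toℕ b < n ∸ k → InStab k (transpose a b)
transpose∈InStab k a<n∸k b<n∸k i n∸k≤i =
  transpose-app-other (λ { refl → <⇒≱ a<n∸k n∸k≤i }) (λ { refl → <⇒≱ b<n∸k n∸k≤i })

transpose∈Conj : ∀ {n} {H : Permutation′ n → Set} (τ : Permutation′ n) {a b : Fin n} →
                 H (transpose a b) → Conj τ H (transpose (τ ⟨$⟩ʳ a) (τ ⟨$⟩ʳ b))
transpose∈Conj τ {a} {b} H∋t = transpose a b , H∋t , sym ∘ transpose-conj τ a b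

module InvariableGeneration {n k : ℕ} (2k<n : 2 * k < n) {σ : Permutation′ n}
                            (long : AllCyclesLongerThan k σ) (τ₁ τ₂ : Permutation′ n) where

  Generators : Permutation′ n → Set
  Generators q = Conj τ₁ (InStab k) q ⊎ Conj τ₂ (InCyclic σ) q

  open Transpositions {P = Generators}

  1+k≤n∸k : suc k ≤ n ∸ k
  1+k≤n∸k = m+n≤o⇒m≤o∸n (suc k) (subst (λ t → suc (k + t) ≤ n) (+-identityʳ k) 2k<n)

  1+k≤n : suc k ≤ n
  1+k≤n = ≤-trans 1+k≤n∸k (m∸n≤m n k)

  -- The conjugated stabiliser fixes exactly the points τ₁ i with n ∸ k ≤ i; the others are free.
  Free : Fin n → Set
  Free a = toℕ (τ₁ ⟨$⟩ˡ a) < n ∸ k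

  free-~ : ∀ {a b} → Free a → Free b → a ~ b
  free-~ a-free b-free = subst₂ _~_ (inverseʳ τ₁) (inverseʳ τ₁)
    (gen (inj₁ (transpose∈Conj τ₁ (transpose∈InStab k a-free b-free))))

  some-free : (h : Fin (suc k) → Fin n) → Injective _≡_ _≡_ h → ∃ λ i → Free (h i)
  some-free h h-inj =
    injective-hits-below (≤-trans (n≤1+n k) 1+k≤n) ((τ₁ ⟨$⟩ˡ_) ∘ h) (h-inj ∘ ⟨$⟩ˡ-injective τ₁)

  free-point : Fin (suc k) → Fin n
  free-point i = τ₁ ⟨$⟩ʳ inject≤ i 1+k≤n

  free-point-free : ∀ i → Free (free-point i)
  free-point-free i = begin-strict
    toℕ (τ₁ ⟨$⟩ˡ free-point i) ≡⟨ cong toℕ (inverseˡ τ₁) ⟩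
    toℕ (inject≤ i 1+k≤n)       ≡⟨ toℕ-inject≤ i 1+k≤n ⟩
    toℕ i                       <⟨ toℕ<n i ⟩
    suc k                       ≤⟨ 1+k≤n∸k ⟩
    n ∸ k                       ∎
    where open ≤-Reasoning

  free-point-injective : Injective _≡_ _≡_ free-point
  free-point-injective = inject≤-injective 1+k≤n 1+k≤n _ _ ∘ ⟨$⟩ʳ-injective τ₁

  s : Permutation′ n
  s = flip τ₂ ∘ₚ σ ∘ₚ τ₂

  s^ₚ-generated : ∀ m → Generated Generators (s ^ₚ m)
  s^ₚ-generated = ^ₚ-generated (gen (inj₂ (σ , gen (λ _ → refl) , λ _ → refl)))

  s-orbit-injective : ∀ x → Injective _≡_ _≡_ (λ (i : Fin (suc k)) → (s ^ₚ toℕ i) ⟨$⟩ʳ x)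
  s-orbit-injective x {i} {j} eq = orbit-injective σ long (τ₂ ⟨$⟩ˡ x)
    (⟨$⟩ʳ-injective τ₂ (trans (sym (^ₚ-conj σ τ₂ (toℕ i) x)) (trans eq (^ₚ-conj σ τ₂ (toℕ j) x))))

  ~-free-point : ∀ x → ∃ λ i → x ~ free-point i
  ~-free-point x =
    let j , qx-free = some-free (λ j → (s ^ₚ toℕ j) ⟨$⟩ʳ x) (s-orbit-injective x)
        q = s ^ₚ toℕ j
        i , qe-free = some-free ((q ⟨$⟩ʳ_) ∘ free-point) (free-point-injective ∘ ⟨$⟩ʳ-injective q)
    in  i , subst₂ _~_ (inverseˡ q) (inverseˡ q) (~-image (inv (s^ₚ-generated (toℕ j))) (free-~ qx-free qe-free))

  all-~ : ∀ a b → a ~ b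
  all-~ a b =
    let i , a~i = ~-free-point a
        j , b~j = ~-free-point b
    in  ~-trans a~i (~-trans (free-~ (free-point-free i) (free-point-free j)) (~-sym b~j))

  generates : ∀ p → Generated Generators p
  generates = generated-by-transpositions all-~

mainTheorem7 : ∀ (n k : ℕ) → 0 < n → 0 < k → 2 * k < n →
    (σ : Permutation′ n) → AllCyclesLongerThan k σ →
    InvariablyGenerate (InStab {n} k) (InCyclic σ)
mainTheorem7 n k _ _ 2k<n σ long τ₁ τ₂ = InvariableGeneration.generates 2k<n long τ₁ τ₂
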